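{- Let $p$ be an odd prime, $n\ge1$, $G=D_{p^n}$, and let $S$ be a minimal generating set for a transfer system $T\in\operatorname{Tr}(G)$. Then: (i) for each of the three arrow types ($C$, $D$, $X$), $S$ contains at most one left-anchored arrow of that type; (ii) if $S$ contains a $D$-arrow of class $(d_0,d_k)$, then $S$ contains no arrow of class $(c_0,c_j)$ for any $j\le k$; the same conclusion holds if instead $S$ contains an $X$-arrow of class $(c_0,d_k)$.
   Context: $G=D_{p^n}=\langle r,s\mid r^{p^n}=s^2=e,\ srs^{ -1}=r^{ -1}\rangle$. For $0\le k\le n$ set $C_{p^k}=\langle r^{p^{n-k}}\rangle$ and $D_{p^k}=\langle r^{p^{n-k}},s\rangle$; let $c_k$ (resp. $d_k$) be the conjugacy class of $C_{p^k}$ (resp. $D_{p^k}$). A $G$-transfer system is a partial order $\to$ on $\operatorname{Sub}(G)$ such that: $K\to H$ implies $K\le H$; $H\to H$; $L\to K\to H$ implies $L\to H$; $K\to H$ and $L\le H$ imply $K\cap L\to H\cap L$; $K\to H$ implies $gKg^{ -1}\to gHg^{ -1}$. An arrow is a pair $(K,H)$ with $K\subsetneq H$; its class is the pair of conjugacy classes of $K$ and $H$. $\langle S\rangle$ is the smallest transfer system containing a set $S$ of arrows; $S$ is a minimal generating set for $T$ if $\langle S\rangle=T$ and no $a\in S$ lies in $\langle S\setminus\{a\}\rangle$. A $C$-arrow has class $(c_i,c_j)$, $0\le i<j\le n$; a $D$-arrow has class $(d_i,d_j)$, $0\le i<j\le n$; an $X$-arrow has class $(c_i,d_j)$, $0\le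 i\le j\le n$. An arrow is left-anchored if its source lies in $c_0$ or $d_0$. -}

module Defs where

open import Data.Nat using (ℕ; zero; suc; _+_; _∸_; _^_; _≤_; _<_; NonZero)
open import Data.Nat.Properties using (m^n≢0)
open import Data.Nat.DivMod using (_mod_)
open import Data.Nat.Divisibility using (_∣_; _∣?_)
open import Data.Fin using (Fin; toℕ)
open import Data.Fin.Subset using (Subset; inside; outside; _∩_)
open import Data.Bool using (Bool; true; false; if_then_else_; _xor_)
open import Data.Vec using (lookup; tabulate)
open import Data.Product using (Σ; ∃; ∃-syntax; _×_; _,_; proj₁; proj₂)
open import Relation.Binary.PropositionalEquality using (_≡_; _≢_)
open import Relation.Nullary.Decidable using (does)
import Data.Empty
import Data.Sum

-- The dihedral group G = D_{p^n} of order 2·p^n.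
-- An element r^a s^b is represented by (a , b) with a : Fin (p^n), b : Bool
-- (b = true means the factor s is present).
module Dihedral (p n : ℕ) (nz : NonZero p) where

  instance
    nzp : NonZero p
    nzp = nz

  m : ℕ
  m = p ^ n

  instance
    nzm : NonZero m
    nzm = m^n≢0 p n

  G : Set
  G = Fin m × Bool

  e : G
  e = (0 mod m , false)

  -- (r^a s^b)(r^c s^d) = r^(a + (-1)^b c) s^(b + d)
  _·_ : G → G → G
  (a , b) · (c , d) =
    ((toℕ a + (if b then m ∸ toℕ c else toℕ c)) mod m , b xor d)

  _⁻¹ : G → G
  (a , false) ⁻¹ = ((m ∸ toℕ a) mod m , false)
  (a , true)  ⁻¹ = (a , true)

  -- A subset of G: (set of a with r^a ∈ H , set of a with r^a s ∈ H).
  SubG : Set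
  SubG = Subset m × Subset m

  memᵇ : G → SubG → Bool
  memᵇ (a , false) H = lookup (proj₁ H) a
  memᵇ (a , true)  H = lookup (proj₂ H) a

  _∈G_ : G → SubG → Set
  x ∈G H = memᵇ x H ≡ true

  record IsSubgroup (H : SubG) : Set where
    field
      has-e   : e ∈G H
      closed· : ∀ x y → x ∈G H → y ∈G H → (x · y) ∈G H
      closed⁻ : ∀ x → x ∈G H → (x ⁻¹) ∈G H

  _≤G_ : SubG → SubG → Set
  K ≤G H = ∀ x → x ∈G K → x ∈G H

  _<G_ : SubG → SubG → Set
  K <G H = K ≤G H × K ≢ H

  _∩G_ : SubG → SubG → SubG
  K ∩G L = (proj₁ K ∩ proj₁ L , proj₂ K ∩ proj₂ L)

  conj : G → SubG → SubG
  conj g H = ( tabulate (λ a → memᵇ ((g ⁻¹) · ((a , false) · g)) H)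
             , tabulate (λ a → memᵇ ((g ⁻¹) · ((a , true) · g)) H) )

  -- C_{p^k} = ⟨ r^(p^(n-k)) ⟩ = { r^a : p^(n-k) ∣ a }
  Cₖ : ℕ → SubG
  Cₖ k = ( tabulate (λ a → does (p ^ (n ∸ k) ∣? toℕ a)) , tabulate (λ _ → false) )

  -- D_{p^k} = ⟨ r^(p^(n-k)) , s ⟩ = { r^a , r^a s : p^(n-k) ∣ a }
  Dₖ : ℕ → SubG
  Dₖ k = ( tabulate (λ a → does (p ^ (n ∸ k) ∣? toℕ a))
         , tabulate (λ a → does (p ^ (n ∸ k) ∣? toℕ a)) )

  InC : ℕ → SubG → Set
  InC k K = ∃[ g ] K ≡ conj g (Cₖ k)

  InD : ℕ → SubG → Set
  InD k K = ∃[ g ] K ≡ conj g (Dₖ k)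

  Rel : Set₁
  Rel = SubG → SubG → Set

  record IsTransferSystem (T : Rel) : Set where
    field
      subgroups  : ∀ K H → T K H → IsSubgroup K × IsSubgroup H
      incl       : ∀ K H → T K H → K ≤G H
      reflexive  : ∀ H → IsSubgroup H → T H H
      transitive : ∀ L K H → T L K → T K H → T L H
      restrict   : ∀ K H L → T K H → IsSubgroup L → L ≤G H → T (K ∩G L) (H ∩G L)
      conjugate  : ∀ K H g → T K H → T (conj g K) (conj g H)

  IsArrow : SubG → SubG → Set
  IsArrow K H = IsSubgroup K × IsSubgroup H × K <G H

  ArrowSet : Set₁
  ArrowSet = Rel

  _⊆R_ : Rel → Rel → Set
  S ⊆R T = ∀ K H → S K H → T K H

  -- ⟨ S ⟩ : the smallest transfer system containing S
  -- (K → H in ⟨S⟩ iff it is in every transfer system containing S)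
  Gen : ArrowSet → SubG → SubG → Set₁
  Gen S K H = (T : Rel) → IsTransferSystem T → S ⊆R T → T K H

  remove : ArrowSet → SubG → SubG → ArrowSet
  remove S K₀ H₀ K H = S K H × (K , H) ≢ (K₀ , H₀)

  record IsMinimalGeneratingSet (S : ArrowSet) (T : Rel) : Set₁ where
    field
      arrows     : ∀ K H → S K H → IsArrow K H
      generates  : ∀ K H → (T K H → Gen S K H) × (Gen S K H → T K H)
      minimal    : ∀ K H → S K H → (Gen (remove S K H) K H → Data.Empty.⊥)

  IsCArrow : SubG → SubG → Set
  IsCArrow K H = ∃[ i ] ∃[ j ] (i < j × j ≤ n × InC i K × InC j H)

  IsDArrow : SubG → SubG → Set
  IsDArrow K H = ∃[ i ] ∃[ j ] (i < j × j ≤ n × InD i K × InD j H)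

  IsXArrow : SubG → SubG → Set
  IsXArrow K H = ∃[ i ] ∃[ j ] (i ≤ j × j ≤ n × InC i K × InD j H)

  LeftAnchored : SubG → SubG → Set
  LeftAnchored K H = InC 0 K Data.Sum.⊎ InD 0 K

-- Every subgroup in the class c_k is the normal subgroup C_{p^k}, and every subgroup in d_k is
-- ⟨r^{p^(n-k)}, r^u s⟩ for some u; conjugating by r^c replaces u by u + 2c, so since p^n is odd
-- a rotation aligns any two such subgroups. An arrow K → H of a minimal generating set S cannot be
-- the restriction to H of a conjugate g(K′ → H′)g⁻¹ of another arrow of S, that is, we cannot have
-- H ≤ gH′g⁻¹ and gK′g⁻¹ ∩ H = K. Of two left-anchored arrows of the same type, the one with the
-- smaller target is such a restriction of the other; and a (c_0, c_j) arrow is the restriction of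
-- any (d_0, d_k) or (c_0, d_k) arrow with j ≤ k.

module Submission where

open import Data.Bool using (Bool; true; false; _∧_)
import Data.Bool.Properties as Bool
open import Data.Empty using (⊥; ⊥-elim)
open import Data.Fin using (Fin; toℕ; fromℕ<)
open import Data.Fin.Properties using (toℕ-fromℕ<; toℕ≤n)
open import Data.Integer using (ℤ; +_; _+_; _-_; _*_; -_; 0ℤ; 1ℤ; -1ℤ)
open import Data.Integer.DivMod using (_%ℕ_; _/ℕ_; n%ℕd<d; a≡a%ℕn+[a/ℕn]*n)
open import Data.Integer.Divisibility.Signed
  using (_∣_; ∣ᵤ⇒∣; ∣⇒∣ᵤ; ∣m∣n⇒∣m+n; ∣m⇒∣-m; ∣n⇒∣m*n; ∣-trans; ∣-refl; _∣?_)
open import Data.Integer.Properties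
  using (+-inverseʳ; +-minus-telescope; +-identityʳ; *-identityˡ; *-assoc; ⊖-≥; m-n≡m⊖n)
open import Data.Integer.Tactic.RingSolver using (solve; solve-∀)
open import Data.List using (_∷_; [])
open import Data.Maybe using (Maybe; just; nothing)
import Data.Maybe as Maybe
open import Data.Nat using (ℕ; zero; suc; _≤_; _∸_; _^_; NonZero; z≤n; s≤s)
import Data.Nat as ℕ
open import Data.Nat.DivMod using (_%_; m%n<n; %-distribˡ-*)
import Data.Nat.Divisibility as ℕ
open import Data.Nat.Primality using (Prime; prime⇒nonZero; prime⇒irreducible)
open import Data.Nat.Properties using (≤-total; ∸-monoʳ-≤; m+[n∸m]≡n; ^-distribˡ-+-*)
open import Data.Product using (_×_; _,_; ∃; ∃-syntax; proj₁; proj₂)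
import Data.Product as Σ
open import Data.Product.Properties using (≡-dec)
open import Data.Sum using (_⊎_; inj₁; inj₂; [_,_]′)
open import Data.Vec using (Vec; lookup; tabulate)
open import Data.Vec.Properties using (lookup∘tabulate; tabulate∘lookup; tabulate-cong; lookup-zipWith)
import Data.Vec.Properties as Vec
open import Defs
open import Function using (_∘_; id)
open import Function.Bundles using (_⇔_; mk⇔; Equivalence)
open import Function.Construct.Composition using (_⇔-∘_)
open import Function.Construct.Identity using (⇔-id)
open import Function.Construct.Symmetry using (⇔-sym)
open import Level using (0ℓ)
open import Relation.Binary.Bundles using (Setoid)
import Relation.Binary.Reasoning.Setoid as SetoidReasoning
open import Relation.Binary.Structures using (IsEquivalence)
open import Relation.Binary.PropositionalEquality
  using (_≡_; _≢_; refl; sym; trans; cong; cong₂; subst; subst₂)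
open import Relation.Nullary using (Dec; yes; no; does)
open import Relation.Nullary.Decidable using (map′; does-⇔)

open Equivalence using (to; from)

prime≢2⇒odd : ∀ {p} → Prime p → p ≢ 2 → p % 2 ≡ 1
prime≢2⇒odd {p} pr p≢2 with p % 2 | m%n<n p 2 | ℕ.m%n≡0⇒n∣m p 2
... | 0 | _ | 2∣p = ⊥-elim ([ (λ ()) , (λ 2≡p → p≢2 (sym 2≡p)) ]′ (prime⇒irreducible pr (2∣p refl)))
... | 1 | _ | _ = refl
... | suc (suc _) | s≤s (s≤s ()) | _

^-odd : ∀ {p} n → p % 2 ≡ 1 → p ^ n % 2 ≡ 1
^-odd zero _ = refl
^-odd {p} (suc n) p-odd =
  trans (%-distribˡ-* p (p ^ n) 2) (cong₂ (λ x y → (x ℕ.* y) % 2) p-odd (^-odd n p-odd))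

pos-∸ : ∀ {a b} → b ≤ a → + (a ∸ b) ≡ + a - + b
pos-∸ {a} {b} b≤a = trans (sym (⊖-≥ b≤a)) (sym (m-n≡m⊖n a b))

^-monoʳ-∣ : ∀ x {a b} → a ≤ b → x ^ a ℕ.∣ x ^ b
^-monoʳ-∣ x {a} {b} a≤b = subst (x ^ a ℕ.∣_) xᵃxᵇ⁻ᵃ≡xᵇ (ℕ.m∣m*n (x ^ (b ∸ a)))
  where
    xᵃxᵇ⁻ᵃ≡xᵇ : x ^ a ℕ.* x ^ (b ∸ a) ≡ x ^ b
    xᵃxᵇ⁻ᵃ≡xᵇ = trans (sym (^-distribˡ-+-* x a (b ∸ a))) (cong (x ^_) (m+[n∸m]≡n a≤b))

does≡true⇔ : ∀ {A : Set} (a? : Dec A) → does a? ≡ true ⇔ A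
does≡true⇔ (yes a) = mk⇔ (λ _ → a) (λ _ → refl)
does≡true⇔ (no ¬a) = mk⇔ (λ ()) (λ a → ⊥-elim (¬a a))

lookup-tabulate-does : ∀ {k} {P : Fin k → Set} (P? : ∀ i → Dec (P i)) i →
                       lookup (tabulate (does ∘ P?)) i ≡ true ⇔ P i
lookup-tabulate-does P? i =
  does≡true⇔ (P? i) ⇔-∘ mk⇔ (trans (sym lookup≡)) (trans lookup≡)
  where lookup≡ = lookup∘tabulate (does ∘ P?) i

∧≡true⇔ : ∀ {x y} → x ∧ y ≡ true ⇔ (x ≡ true × y ≡ true)
∧≡true⇔ {true}  = mk⇔ (λ y≡true → refl , y≡true) proj₂
∧≡true⇔ {false} = mk⇔ (λ ()) (λ ())

Bool-ext : ∀ {x y} → (x ≡ true → y ≡ true) → (y ≡ true → x ≡ true) → x ≡ y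
Bool-ext {false} {false} _ _ = refl
Bool-ext {false} {true}  _ g = g refl
Bool-ext {true}  {false} f _ = sym (f refl)
Bool-ext {true}  {true}  _ _ = refl

Vec-Bool-ext : ∀ {k} {v w : Vec Bool k} →
               (∀ i → lookup v i ≡ true → lookup w i ≡ true) →
               (∀ i → lookup w i ≡ true → lookup v i ≡ true) → v ≡ w
Vec-Bool-ext {v = v} {w} f g =
  trans (sym (tabulate∘lookup v))
        (trans (tabulate-cong (λ i → Bool-ext (f i) (g i))) (tabulate∘lookup w))

-- Congruences of integers

-- A record rather than a definition, so that x, y and q can be inferred from a proof.
infix 4 _≡_mod_

record _≡_mod_ (x y : ℤ) (q : ℕ) : Set where
  constructor ≡-mod
  field divides-difference : + q ∣ x - y

open _≡_mod_

module _ {q : ℕ} where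

  ∣⇒≡-mod : ∀ {d x y} → + q ∣ d → d ≡ x - y → x ≡ y mod q
  ∣⇒≡-mod q∣d refl = ≡-mod q∣d

  ≡-mod-reflexive : ∀ {x y} → x ≡ y → x ≡ y mod q
  ≡-mod-reflexive {x} refl = ∣⇒≡-mod (∣ᵤ⇒∣ (ℕ._∣0 q)) (sym (+-inverseʳ x))

  ≡-mod-refl : ∀ {x} → x ≡ x mod q
  ≡-mod-refl = ≡-mod-reflexive refl

  ≡-mod-sym : ∀ {x y} → x ≡ y mod q → y ≡ x mod q
  ≡-mod-sym {x} {y} (≡-mod d) = ∣⇒≡-mod (∣m⇒∣-m d) (solve (x ∷ y ∷ []))

  ≡-mod-trans : ∀ {x y z} → x ≡ y mod q → y ≡ z mod q → x ≡ z mod q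
  ≡-mod-trans {x} {y} {z} (≡-mod d) (≡-mod d′) =
    ∣⇒≡-mod (∣m∣n⇒∣m+n d d′) (+-minus-telescope x y z)

  +-cong-mod : ∀ {x y z w} → x ≡ y mod q → z ≡ w mod q → x + z ≡ y + w mod q
  +-cong-mod {x} {y} {z} {w} (≡-mod d) (≡-mod d′) =
    ∣⇒≡-mod (∣m∣n⇒∣m+n d d′) (solve (x ∷ y ∷ z ∷ w ∷ []))

  *-congˡ-mod : ∀ c {x y} → x ≡ y mod q → c * x ≡ c * y mod q
  *-congˡ-mod c {x} {y} (≡-mod d) = ∣⇒≡-mod (∣n⇒∣m*n c d) (solve (c ∷ x ∷ y ∷ []))

  +-multiple-mod : ∀ x {k} → + q ∣ k → x + k ≡ x mod q
  +-multiple-mod x {k} q∣k = ∣⇒≡-mod q∣k (solve (x ∷ k ∷ []))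

≡-mod-isEquivalence : ∀ q → IsEquivalence (_≡_mod q)
≡-mod-isEquivalence q = record { refl = ≡-mod-refl ; sym = ≡-mod-sym ; trans = ≡-mod-trans }

≡-mod-setoid : ℕ → Setoid 0ℓ 0ℓ
≡-mod-setoid q = record { isEquivalence = ≡-mod-isEquivalence q }

module ≡-mod-Reasoning (q : ℕ) = SetoidReasoning (≡-mod-setoid q)

infix 4 _≡?_mod_
_≡?_mod_ : ∀ x y q → Dec (x ≡ y mod q)
x ≡? y mod q = map′ ≡-mod divides-difference (+ q ∣? x - y)

≡-mod-divisor : ∀ {q q′ x y} → q′ ℕ.∣ q → x ≡ y mod q → x ≡ y mod q′
≡-mod-divisor q′∣q (≡-mod d) = ≡-mod (∣-trans (∣ᵤ⇒∣ q′∣q) d)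

≡0-mod⇔∣ : ∀ {q a} → + a ≡ 0ℤ mod q ⇔ q ℕ.∣ a
≡0-mod⇔∣ {q} {a} = mk⇔
  (λ (≡-mod d) → ∣⇒∣ᵤ (subst (+ q ∣_) (+-identityʳ (+ a)) d))
  (λ q∣a → ≡-mod (subst (+ q ∣_) (sym (+-identityʳ (+ a))) (∣ᵤ⇒∣ q∣a)))

unit-cancel : ∀ {ε} → ε * ε ≡ 1ℤ → ∀ x → ε * (ε * x) ≡ x
unit-cancel {ε} ε²≡1 x = trans (sym (*-assoc ε ε x)) (trans (cong (_* x) ε²≡1) (*-identityˡ x))

-- v and r are parameters so that callers may supply them in any provably equal form.
≡-mod-unit⇔ : ∀ ε w {q v a u r} → ε * ε ≡ 1ℤ → v ≡ ε * (a - w) → w + ε * u ≡ r →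
              v ≡ u mod q ⇔ a ≡ r mod q
≡-mod-unit⇔ ε w {q} {v} {a} {u} {r} ε²≡1 refl refl = mk⇔ isolate substitute
  where
    open ≡-mod-Reasoning q
    add-sub : ∀ x y → x + (y - x) ≡ y
    add-sub = solve-∀
    sub-add : ∀ x y → (x + y) - x ≡ y
    sub-add = solve-∀
    isolate : ε * (a - w) ≡ u mod q → a ≡ w + ε * u mod q
    isolate h = begin
      a                          ≡⟨ sym (add-sub w a) ⟩
      w + (a - w)                ≡⟨ cong (_+_ w) (sym (unit-cancel {ε} ε²≡1 (a - w))) ⟩
      w + ε * (ε * (a - w))      ≈⟨ +-cong-mod {x = w} ≡-mod-refl (*-congˡ-mod ε h) ⟩
      w + ε * u                  ∎
    substitute : a ≡ w + ε * u mod q → ε * (a - w) ≡ u mod q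
    substitute h = begin
      ε * (a - w)                ≈⟨ *-congˡ-mod ε (+-cong-mod h ≡-mod-refl) ⟩
      ε * ((w + ε * u) - w)      ≡⟨ cong (ε *_) (sub-add w (ε * u)) ⟩
      ε * (ε * u)                ≡⟨ unit-cancel {ε} ε²≡1 u ⟩
      u                          ∎

residue : ∀ {M} .{{_ : NonZero M}} → ℤ → Fin M
residue {M} v = fromℕ< (n%ℕd<d v M)

+toℕ-residue : ∀ {M} .{{_ : NonZero M}} v → + toℕ (residue {M} v) ≡ v mod M
+toℕ-residue {M} v = begin
  + toℕ (residue {M} v)             ≡⟨ cong +_ (toℕ-fromℕ< (n%ℕd<d v M)) ⟩
  + (v %ℕ M)                        ≈⟨ ≡-mod-sym (+-multiple-mod _ (∣n⇒∣m*n (v /ℕ M) ∣-refl)) ⟩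
  + (v %ℕ M) + (v /ℕ M) * + M       ≡⟨ sym (a≡a%ℕn+[a/ℕn]*n v M) ⟩
  v                                 ∎
  where open ≡-mod-Reasoning M

sign : Bool → ℤ
sign false = 1ℤ
sign true  = -1ℤ

sign² : ∀ b → sign b * sign b ≡ 1ℤ
sign² false = refl
sign² true  = refl

-- For odd M = 1 + 2h, the integer 1 + h is an inverse of 2 modulo M.
halve : ∀ {M} .{{_ : NonZero M}} → M % 2 ≡ 1 → ∀ v → ∃[ c ] + 2 * + toℕ {M} c ≡ v mod M
halve {M} M-odd v = residue ((1ℤ + h) * v) , (begin
  + 2 * + toℕ (residue {M} ((1ℤ + h) * v))  ≈⟨ *-congˡ-mod (+ 2) (+toℕ-residue ((1ℤ + h) * v)) ⟩
  + 2 * ((1ℤ + h) * v)                      ≡⟨ expand h v ⟩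
  v + v * (1ℤ + h * + 2)                    ≡⟨ cong (λ z → v + v * z) (sym M≡1+2h) ⟩
  v + v * + M                               ≈⟨ +-multiple-mod v (∣n⇒∣m*n v ∣-refl) ⟩
  v                                         ∎)
  where
    open ≡-mod-Reasoning M
    h = + M /ℕ 2
    M≡1+2h : + M ≡ 1ℤ + h * + 2
    M≡1+2h = trans (a≡a%ℕn+[a/ℕn]*n (+ M) 2) (cong (λ r → + r + h * + 2) M-odd)
    expand : ∀ h v → + 2 * ((1ℤ + h) * v) ≡ v + v * (1ℤ + h * + 2)
    expand = solve-∀

module DihedralSubgroups (p n : ℕ) (nz : NonZero p) where
  open Dihedral p n nz

  ≤G-antisym : ∀ {X Y} → X ≤G Y → Y ≤G X → X ≡ Y
  ≤G-antisym X≤Y Y≤X = cong₂ _,_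
    (Vec-Bool-ext (λ a → X≤Y (a , false)) (λ a → Y≤X (a , false)))
    (Vec-Bool-ext (λ a → X≤Y (a , true))  (λ a → Y≤X (a , true)))

  SubG-ext : ∀ {X Y} → (∀ x → x ∈G X ⇔ x ∈G Y) → X ≡ Y
  SubG-ext X⇔Y = ≤G-antisym (λ x → to (X⇔Y x)) (λ x → from (X⇔Y x))

  _≟_ : (A B : SubG × SubG) → Dec (A ≡ B)
  _≟_ = ≡-dec (≡-dec SubVec-≟ SubVec-≟) (≡-dec SubVec-≟ SubVec-≟)
    where SubVec-≟ = Vec.≡-dec Bool._≟_

  ∈∩⇔ : ∀ x X Y → x ∈G (X ∩G Y) ⇔ (x ∈G X × x ∈G Y)
  ∈∩⇔ x X Y = ∧≡true⇔ ⇔-∘ mk⇔ (trans (sym (memᵇ-∩ x))) (trans (memᵇ-∩ x))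
    where
      memᵇ-∩ : ∀ x → memᵇ x (X ∩G Y) ≡ memᵇ x X ∧ memᵇ x Y
      memᵇ-∩ (a , false) = lookup-zipWith _∧_ a (proj₁ X) (proj₁ Y)
      memᵇ-∩ (a , true)  = lookup-zipWith _∧_ a (proj₂ X) (proj₂ Y)

  ≤G⇒∩≡ˡ : ∀ {X Y} → X ≤G Y → X ∩G Y ≡ X
  ≤G⇒∩≡ˡ {X} {Y} X≤Y = ≤G-antisym
    (λ x → proj₁ ∘ to (∈∩⇔ x X Y))
    (λ x x∈X → from (∈∩⇔ x X Y) (x∈X , X≤Y x x∈X))

  ≤G⇒∩≡ʳ : ∀ {X Y} → Y ≤G X → X ∩G Y ≡ Y
  ≤G⇒∩≡ʳ {X} {Y} Y≤X = ≤G-antisym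
    (λ x → proj₂ ∘ to (∈∩⇔ x X Y))
    (λ x x∈Y → from (∈∩⇔ x X Y) (Y≤X x x∈Y , x∈Y))

  ∈conj⇔ : ∀ g X x → x ∈G conj g X ⇔ ((g ⁻¹) · (x · g)) ∈G X
  ∈conj⇔ g X x = mk⇔ (trans (sym (memᵇ-conj x))) (trans (memᵇ-conj x))
    where
      memᵇ-conj : ∀ x → memᵇ x (conj g X) ≡ memᵇ ((g ⁻¹) · (x · g)) X
      memᵇ-conj (a , false) = lookup∘tabulate _ a
      memᵇ-conj (a , true)  = lookup∘tabulate _ a

  rot : G → ℤ
  rot (a , _) = + toℕ a

  rot-· : ∀ x y → rot (x · y) ≡ rot x + sign (proj₂ x) * rot y mod m
  rot-· (a , false) (c , d) = begin
    rot ((a , false) · (c , d))     ≈⟨ +toℕ-residue (+ (toℕ a ℕ.+ toℕ c)) ⟩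
    + toℕ a + + toℕ c               ≡⟨ cong (_+_ (+ toℕ a)) (sym (*-identityˡ (+ toℕ c))) ⟩
    + toℕ a + 1ℤ * + toℕ c          ∎
    where open ≡-mod-Reasoning m
  rot-· (a , true) (c , d) = begin
    rot ((a , true) · (c , d))            ≈⟨ +toℕ-residue (+ (toℕ a ℕ.+ (m ∸ toℕ c))) ⟩
    + toℕ a + + (m ∸ toℕ c)               ≡⟨ cong (_+_ (+ toℕ a)) (pos-∸ (toℕ≤n c)) ⟩
    + toℕ a + (+ m - + toℕ c)             ≡⟨ rearrange (+ toℕ a) (+ toℕ c) (+ m) ⟩
    + toℕ a + -1ℤ * + toℕ c + + m         ≈⟨ +-multiple-mod _ ∣-refl ⟩
    + toℕ a + -1ℤ * + toℕ c               ∎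
    where
      open ≡-mod-Reasoning m
      rearrange : ∀ a c m → a + (m - c) ≡ a + -1ℤ * c + m
      rearrange = solve-∀

  rot-⁻¹ : ∀ g → rot (g ⁻¹) ≡ - (sign (proj₂ g) * rot g) mod m
  rot-⁻¹ (a , false) = begin
    rot ((a , false) ⁻¹)      ≈⟨ +toℕ-residue (+ (m ∸ toℕ a)) ⟩
    + (m ∸ toℕ a)             ≡⟨ pos-∸ (toℕ≤n a) ⟩
    + m - + toℕ a             ≡⟨ rearrange (+ toℕ a) (+ m) ⟩
    - (1ℤ * + toℕ a) + + m    ≈⟨ +-multiple-mod _ ∣-refl ⟩
    - (1ℤ * + toℕ a)          ∎
    where
      open ≡-mod-Reasoning m
      rearrange : ∀ a m → m - a ≡ - (1ℤ * a) + m
      rearrange = solve-∀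
  rot-⁻¹ (a , true) = ≡-mod-reflexive (double-negation (+ toℕ a))
    where
      double-negation : ∀ a → a ≡ - (-1ℤ * a)
      double-negation = solve-∀

  flag-⁻¹ : ∀ g → proj₂ (g ⁻¹) ≡ proj₂ g
  flag-⁻¹ (_ , false) = refl
  flag-⁻¹ (_ , true)  = refl

  flag-conj : ∀ g x → proj₂ ((g ⁻¹) · (x · g)) ≡ proj₂ x
  flag-conj (_ , false) (_ , false) = refl
  flag-conj (_ , false) (_ , true)  = refl
  flag-conj (_ , true)  (_ , false) = refl
  flag-conj (_ , true)  (_ , true)  = refl

  rot-conj : ∀ g x → rot ((g ⁻¹) · (x · g)) ≡
             sign (proj₂ g) * (rot x + sign (proj₂ x) * rot g - rot g) mod m
  rot-conj g x = begin
    rot ((g ⁻¹) · (x · g))                         ≈⟨ rot-· (g ⁻¹) (x · g) ⟩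
    rot (g ⁻¹) + sign (proj₂ (g ⁻¹)) * rot (x · g)
      ≡⟨ cong (λ b → rot (g ⁻¹) + sign b * rot (x · g)) (flag-⁻¹ g) ⟩
    rot (g ⁻¹) + ε * rot (x · g)                   ≈⟨ +-cong-mod (rot-⁻¹ g) (*-congˡ-mod ε (rot-· x g)) ⟩
    - (ε * rot g) + ε * (rot x + s * rot g)        ≡⟨ distribute ε s (rot x) (rot g) ⟩
    ε * (rot x + s * rot g - rot g)                ∎
    where
      open ≡-mod-Reasoning m
      ε = sign (proj₂ g)
      s = sign (proj₂ x)
      distribute : ∀ ε s a c → - (ε * c) + ε * (a + s * c) ≡ ε * (a + s * c - c)
      distribute = solve-∀

  -- The subgroups C_{p^k} and ⟨r^{p^(n-k)}, r^u s⟩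

  index : ℕ → ℕ
  index k = p ^ (n ∸ k)

  index-antitone : ∀ {j k} → j ≤ k → index k ℕ.∣ index j
  index-antitone j≤k = ^-monoʳ-∣ p (∸-monoʳ-≤ n j≤k)

  index∣m : ∀ k → index k ℕ.∣ m
  index∣m k = index-antitone {k = k} z≤n

  -- Std k nothing is C_{p^k}, Std k (just u) is ⟨r^{p^(n-k)}, r^u s⟩, and InStd k ρ t v says that
  -- r^v s^t belongs to Std k ρ.
  InStd : ℕ → Maybe ℤ → Bool → ℤ → Set
  InStd k _        false v = v ≡ 0ℤ mod index k
  InStd k nothing  true  v = ⊥
  InStd k (just u) true  v = v ≡ u mod index k

  InStd? : ∀ k ρ t v → Dec (InStd k ρ t v)
  InStd? k _        false v = v ≡? 0ℤ mod index k
  InStd? k nothing  true  v = no id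
  InStd? k (just u) true  v = v ≡? u mod index k

  Std : ℕ → Maybe ℤ → SubG
  Std k ρ = tabulate (λ a → does (InStd? k ρ false (+ toℕ a)))
          , tabulate (λ a → does (InStd? k ρ true (+ toℕ a)))

  ∈Std⇔ : ∀ k ρ x → x ∈G Std k ρ ⇔ InStd k ρ (proj₂ x) (rot x)
  ∈Std⇔ k ρ (a , false) = lookup-tabulate-does (λ a → InStd? k ρ false (+ toℕ a)) a
  ∈Std⇔ k ρ (a , true)  = lookup-tabulate-does (λ a → InStd? k ρ true (+ toℕ a)) a

  InStd-resp : ∀ k ρ t {v w} → v ≡ w mod index k → InStd k ρ t v ⇔ InStd k ρ t w
  InStd-resp k _        false v≡w = mk⇔ (≡-mod-trans (≡-mod-sym v≡w)) (≡-mod-trans v≡w)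
  InStd-resp k nothing  true  _   = ⇔-id _
  InStd-resp k (just u) true  v≡w = mk⇔ (≡-mod-trans (≡-mod-sym v≡w)) (≡-mod-trans v≡w)

  conj-offset : G → Maybe ℤ → Maybe ℤ
  conj-offset g = Maybe.map (λ u → + 2 * rot g + sign (proj₂ g) * u)

  InStd-sign : ∀ k ρ b t a c →
               InStd k ρ t (sign b * (a + sign t * c - c)) ⇔
               InStd k (Maybe.map (λ u → + 2 * c + sign b * u) ρ) t a
  InStd-sign k _ b false a c =
    ≡-mod-unit⇔ (sign b) 0ℤ (sign² b) (cong (sign b *_) (no-shift a c)) (no-offset (sign b))
    where
      no-shift : ∀ a c → a + 1ℤ * c - c ≡ a - 0ℤ
      no-shift = solve-∀
      no-offset : ∀ ε → 0ℤ + ε * 0ℤ ≡ 0ℤ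
      no-offset = solve-∀
  InStd-sign k nothing b true a c = ⇔-id _
  InStd-sign k (just u) b true a c =
    ≡-mod-unit⇔ (sign b) (+ 2 * c) (sign² b) (cong (sign b *_) (double-shift a c)) refl
    where
      double-shift : ∀ a c → a + -1ℤ * c - c ≡ a - + 2 * c
      double-shift = solve-∀

  InStd-conj : ∀ k ρ g x →
               InStd k ρ (proj₂ ((g ⁻¹) · (x · g))) (rot ((g ⁻¹) · (x · g))) ⇔
               InStd k (conj-offset g ρ) (proj₂ x) (rot x)
  InStd-conj k ρ g x =
    subst (λ t → InStd k ρ t (rot ((g ⁻¹) · (x · g))) ⇔ InStd k (conj-offset g ρ) (proj₂ x) (rot x))
          (sym (flag-conj g x))
      (InStd-sign k ρ (proj₂ g) (proj₂ x) (rot x) (rot g)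
        ⇔-∘ InStd-resp k ρ (proj₂ x) (≡-mod-divisor (index∣m k) (rot-conj g x)))

  conj-Std : ∀ g k ρ → conj g (Std k ρ) ≡ Std k (conj-offset g ρ)
  conj-Std g k ρ = SubG-ext λ x →
    ⇔-sym (∈Std⇔ k (conj-offset g ρ) x)
      ⇔-∘ (InStd-conj k ρ g x ⇔-∘ (∈Std⇔ k ρ ((g ⁻¹) · (x · g)) ⇔-∘ ∈conj⇔ g (Std k ρ) x))

  Std-mono : ∀ {j k} ρ → j ≤ k → Std j ρ ≤G Std k ρ
  Std-mono {j} {k} ρ j≤k x = from (∈Std⇔ k ρ x) ∘ InStd-mono ρ (proj₂ x) ∘ to (∈Std⇔ j ρ x)
    where
      InStd-mono : ∀ ρ t {v} → InStd j ρ t v → InStd k ρ t v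
      InStd-mono _        false = ≡-mod-divisor (index-antitone j≤k)
      InStd-mono nothing  true  ()
      InStd-mono (just u) true  = ≡-mod-divisor (index-antitone j≤k)

  cyclic≤Std : ∀ k ρ → Std k nothing ≤G Std k ρ
  cyclic≤Std k ρ (a , false) = from (∈Std⇔ k ρ (a , false)) ∘ to (∈Std⇔ k nothing (a , false))
  cyclic≤Std k ρ (a , true)  = ⊥-elim ∘ to (∈Std⇔ k nothing (a , true))

  Std-cong : ∀ k {u v} → u ≡ v mod index k → Std k (just u) ≡ Std k (just v)
  Std-cong k {u} {v} u≡v = SubG-ext λ x →
    ⇔-sym (∈Std⇔ k (just v) x) ⇔-∘ (offset-resp (proj₂ x) ⇔-∘ ∈Std⇔ k (just u) x)
    where
      offset-resp : ∀ t {w} → InStd k (just u) t w ⇔ InStd k (just v) t w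
      offset-resp false = ⇔-id _
      offset-resp true  = mk⇔ (λ w≡u → ≡-mod-trans w≡u u≡v) (λ w≡v → ≡-mod-trans w≡v (≡-mod-sym u≡v))

  Std-∩-cyclic : ∀ {i j} ρ → i ≤ j → Std i ρ ∩G Std j nothing ≡ Std i nothing
  Std-∩-cyclic {i} {j} ρ i≤j = ≤G-antisym ⊆ ⊇
    where
      ∈both : ∀ x → x ∈G (Std i ρ ∩G Std j nothing) → x ∈G Std i ρ × x ∈G Std j nothing
      ∈both x = to (∈∩⇔ x (Std i ρ) (Std j nothing))
      ⊆ : (Std i ρ ∩G Std j nothing) ≤G Std i nothing
      ⊆ x@(_ , false) h = from (∈Std⇔ i nothing x) (to (∈Std⇔ i ρ x) (proj₁ (∈both x h)))
      ⊆ x@(_ , true)  h = ⊥-elim (to (∈Std⇔ j nothing x) (proj₂ (∈both x h)))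
      ⊇ : Std i nothing ≤G (Std i ρ ∩G Std j nothing)
      ⊇ x h = from (∈∩⇔ x (Std i ρ) (Std j nothing)) (cyclic≤Std i ρ x h , Std-mono nothing i≤j x h)

  reflection∈Std : ∀ k u → (residue u , true) ∈G Std k (just u)
  reflection∈Std k u =
    from (∈Std⇔ k (just u) (residue u , true)) (≡-mod-divisor (index∣m k) (+toℕ-residue u))

  cyclic≢Std : ∀ i j u → Std i nothing ≢ Std j (just u)
  cyclic≢Std i j u eq = to (∈Std⇔ i nothing x) (subst (x ∈G_) (sym eq) (reflection∈Std j u))
    where
      x : G
      x = residue u , true

  Std-offset-≤ : ∀ i j {u v} → Std i (just u) ≤G Std j (just v) → u ≡ v mod index j
  Std-offset-≤ i j {u} {v} le = ≡-mod-trans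
    (≡-mod-sym (≡-mod-divisor (index∣m j) (+toℕ-residue u)))
    (to (∈Std⇔ j (just v) (residue u , true)) (le (residue u , true) (reflection∈Std i u)))

  rotations-Std : ∀ k ρ → tabulate (λ a → does (index k ℕ.∣? toℕ a)) ≡ proj₁ (Std k ρ)
  rotations-Std k ρ = tabulate-cong λ a →
    does-⇔ (⇔-sym ≡0-mod⇔∣) (index k ℕ.∣? toℕ a) (+ toℕ a ≡? 0ℤ mod index k)

  Cₖ≡Std : ∀ k → Cₖ k ≡ Std k nothing
  Cₖ≡Std k = cong (_, _) (rotations-Std k nothing)

  Dₖ≡Std : ∀ k → Dₖ k ≡ Std k (just 0ℤ)
  Dₖ≡Std k = cong₂ _,_ (rotations-Std k (just 0ℤ)) (rotations-Std k (just 0ℤ))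

  InC⇒Std : ∀ {i K} → InC i K → K ≡ Std i nothing
  InC⇒Std {i} (g , refl) = trans (cong (conj g) (Cₖ≡Std i)) (conj-Std g i nothing)

  InD⇒Std : ∀ {i K} → InD i K → ∃[ u ] K ≡ Std i (just u)
  InD⇒Std {i} (g , refl) =
    + 2 * rot g + sign (proj₂ g) * 0ℤ , trans (cong (conj g) (Dₖ≡Std i)) (conj-Std g i (just 0ℤ))

  InC×InD⇒⊥ : ∀ {i j K} → InC i K → InD j K → ⊥
  InC×InD⇒⊥ {i} {j} c d with InD⇒Std {j} d
  ... | u , K≡Std = cyclic≢Std i j u (trans (sym (InC⇒Std {i} c)) K≡Std)

  aligning-rotation : m % 2 ≡ 1 → ∀ u u′ → ∃[ g ] ∀ k → conj g (Std k (just u′)) ≡ Std k (just u)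
  aligning-rotation m-odd u u′ = (c , false) , λ k →
    trans (conj-Std (c , false) k (just u′)) (Std-cong k (≡-mod-divisor (index∣m k) shifted))
    where
      open ≡-mod-Reasoning m
      c = proj₁ (halve {m} m-odd (u - u′))
      cancel : ∀ u u′ → u - u′ + 1ℤ * u′ ≡ u
      cancel = solve-∀
      shifted : + 2 * + toℕ c + 1ℤ * u′ ≡ u mod m
      shifted = begin
        + 2 * + toℕ c + 1ℤ * u′ ≈⟨ +-cong-mod (proj₂ (halve {m} m-odd (u - u′))) ≡-mod-refl ⟩
        u - u′ + 1ℤ * u′        ≡⟨ cancel u u′ ⟩
        u                       ∎

  AnchoredC AnchoredD AnchoredX : SubG → SubG → ℕ → Set
  AnchoredC K H j = K ≡ Std 0 nothing × H ≡ Std j nothing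
  AnchoredD K H j = ∃[ u ] K ≡ Std 0 (just u) × H ≡ Std j (just u)
  AnchoredX K H j = ∃[ u ] K ≡ Std 0 nothing × H ≡ Std j (just u)

  anchoredC : ∀ {K H} → IsCArrow K H → LeftAnchored K H → ∃ (AnchoredC K H)
  anchoredC (_ , j , _ , _ , _  , cH) (inj₁ c0) = j , InC⇒Std {0} c0 , InC⇒Std {j} cH
  anchoredC (i , _ , _ , _ , cK , _)  (inj₂ d0) = ⊥-elim (InC×InD⇒⊥ {i} {0} cK d0)

  anchoredD : ∀ {K H} → IsDArrow K H → LeftAnchored K H → K ≤G H → ∃ (AnchoredD K H)
  anchoredD (i , _ , _ , _ , dK , _) (inj₁ c0) _ = ⊥-elim (InC×InD⇒⊥ {0} {i} c0 dK)
  anchoredD (_ , j , _ , _ , _ , dH) (inj₂ d0) K≤H with InD⇒Std {0} d0 | InD⇒Std {j} dH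
  ... | u , refl | v , refl = j , u , refl , Std-cong j (≡-mod-sym (Std-offset-≤ 0 j {u} {v} K≤H))

  anchoredX : ∀ {K H} → IsXArrow K H → LeftAnchored K H → ∃ (AnchoredX K H)
  anchoredX (_ , j , _ , _ , _  , dH) (inj₁ c0) with InD⇒Std {j} dH
  ... | u , H≡Std = j , u , InC⇒Std {0} c0 , H≡Std
  anchoredX (i , _ , _ , _ , cK , _)  (inj₂ d0) = ⊥-elim (InC×InD⇒⊥ {i} {0} cK d0)

  -- Minimal generating sets

  module MinimalGeneratingSet (m-odd : m % 2 ≡ 1) {T : Rel} {S : ArrowSet}
                              (ms : IsMinimalGeneratingSet S T) where
    open IsMinimalGeneratingSet ms

    source≤target : ∀ {K H} → S K H → K ≤G H
    source≤target {K} {H} s = proj₁ (proj₂ (proj₂ (arrows K H s)))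

    redundant : ∀ {K H K′ H′} → S K H → S K′ H′ → (K′ , H′) ≢ (K , H) → ∀ g →
                H ≤G conj g H′ → (conj g K′ ∩G H) ≡ K → ⊥
    redundant {K} {H} {K′} {H′} s s′ ne g H≤gH′ gK′∩H≡K = minimal K H s λ T′ T′-transfer S∖KH⊆T′ →
      let open IsTransferSystem T′-transfer in
      subst₂ T′ gK′∩H≡K (≤G⇒∩≡ʳ H≤gH′)
        (restrict (conj g K′) (conj g H′) H (conjugate K′ H′ g (S∖KH⊆T′ K′ H′ (s′ , ne)))
                  (proj₁ (proj₂ (arrows K H s))) H≤gH′)

    redundant-by-conjugate : ∀ {K H K′ H′} → S K H → S K′ H′ → (K′ , H′) ≢ (K , H) → ∀ g →
                             conj g K′ ≡ K → H ≤G conj g H′ → ⊥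
    redundant-by-conjugate {H = H} s s′ ne g gK′≡K H≤gH′ =
      redundant s s′ ne g H≤gH′ (trans (cong (_∩G H) gK′≡K) (≤G⇒∩≡ˡ (source≤target s)))

    unique-by-level : ∀ {Level : SubG → SubG → ℕ → Set} →
      (∀ {K H K′ H′ j j′} → S K H → S K′ H′ → (K′ , H′) ≢ (K , H) →
         Level K H j → Level K′ H′ j′ → j ≤ j′ → ⊥) →
      ∀ {K H K′ H′} → S K H → S K′ H′ → ∃ (Level K H) → ∃ (Level K′ H′) → (K , H) ≡ (K′ , H′)
    unique-by-level redundant-below {K} {H} {K′} {H′} s s′ (j , l) (j′ , l′) with (K , H) ≟ (K′ , H′)
    ... | yes KH≡K′H′ = KH≡K′H′
    ... | no KH≢K′H′ with ≤-total j j′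
    ...   | inj₁ j≤j′ = ⊥-elim (redundant-below s s′ (KH≢K′H′ ∘ sym) l l′ j≤j′)
    ...   | inj₂ j′≤j = ⊥-elim (redundant-below s′ s KH≢K′H′ l′ l j′≤j)

    C-redundant : ∀ {K H K′ H′ j j′} → S K H → S K′ H′ → (K′ , H′) ≢ (K , H) →
                  AnchoredC K H j → AnchoredC K′ H′ j′ → j ≤ j′ → ⊥
    C-redundant {j = j} {j′} s s′ ne (refl , refl) (refl , refl) j≤j′ =
      redundant-by-conjugate s s′ ne e (conj-Std e 0 nothing)
        (subst (Std j nothing ≤G_) (sym (conj-Std e j′ nothing)) (Std-mono nothing j≤j′))

    D-redundant : ∀ {K H K′ H′ j j′} → S K H → S K′ H′ → (K′ , H′) ≢ (K , H) →
                  AnchoredD K H j → AnchoredD K′ H′ j′ → j ≤ j′ → ⊥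
    D-redundant {j = j} {j′} s s′ ne (u , refl , refl) (u′ , refl , refl) j≤j′ =
      redundant-by-conjugate s s′ ne g (align 0)
        (subst (Std j (just u) ≤G_) (sym (align j′)) (Std-mono (just u) j≤j′))
      where
        g = proj₁ (aligning-rotation m-odd u u′)
        align = proj₂ (aligning-rotation m-odd u u′)

    X-redundant : ∀ {K H K′ H′ j j′} → S K H → S K′ H′ → (K′ , H′) ≢ (K , H) →
                  AnchoredX K H j → AnchoredX K′ H′ j′ → j ≤ j′ → ⊥
    X-redundant {j = j} {j′} s s′ ne (u , refl , refl) (u′ , refl , refl) j≤j′ =
      redundant-by-conjugate s s′ ne g (conj-Std g 0 nothing)
        (subst (Std j (just u) ≤G_) (sym (align j′)) (Std-mono (just u) j≤j′))
      where
        g = proj₁ (aligning-rotation m-odd u u′)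
        align = proj₂ (aligning-rotation m-odd u u′)

    cyclic-redundant : ∀ {K H K′ H′ k j} → S K H → S K′ H′ →
                       ∃[ ρ ] K ≡ Std 0 ρ → ∃[ u ] H ≡ Std k (just u) →
                       K′ ≡ Std 0 nothing → H′ ≡ Std j nothing → j ≤ k → ⊥
    cyclic-redundant {k = k} {j} s s′ (ρ , refl) (u , refl) refl refl j≤k =
      redundant s′ s a≢b e H′≤eH eK∩H′≡K′
      where
        a≢b : (Std 0 ρ , Std k (just u)) ≢ (Std 0 nothing , Std j nothing)
        a≢b eq = cyclic≢Std j k u (sym (cong proj₂ eq))
        H′≤eH : Std j nothing ≤G conj e (Std k (just u))
        H′≤eH = subst (Std j nothing ≤G_) (sym (conj-Std e k (just u)))
                 (λ x → cyclic≤Std k (conj-offset e (just u)) x ∘ Std-mono nothing j≤k x)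
        eK∩H′≡K′ : (conj e (Std 0 ρ) ∩G Std j nothing) ≡ Std 0 nothing
        eK∩H′≡K′ = trans (cong (_∩G Std j nothing) (conj-Std e 0 ρ))
                         (Std-∩-cyclic {0} {j} (conj-offset e ρ) z≤n)

    C-unique : ∀ K H K′ H′ → S K H → S K′ H′ →
               IsCArrow K H → LeftAnchored K H → IsCArrow K′ H′ → LeftAnchored K′ H′ →
               (K , H) ≡ (K′ , H′)
    C-unique _ _ _ _ s s′ c a c′ a′ = unique-by-level C-redundant s s′ (anchoredC c a) (anchoredC c′ a′)

    D-unique : ∀ K H K′ H′ → S K H → S K′ H′ →
               IsDArrow K H → LeftAnchored K H → IsDArrow K′ H′ → LeftAnchored K′ H′ →
               (K , H) ≡ (K′ , H′)
    D-unique _ _ _ _ s s′ d a d′ a′ =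
      unique-by-level D-redundant s s′
        (anchoredD d a (source≤target s)) (anchoredD d′ a′ (source≤target s′))

    X-unique : ∀ K H K′ H′ → S K H → S K′ H′ →
               IsXArrow K H → LeftAnchored K H → IsXArrow K′ H′ → LeftAnchored K′ H′ →
               (K , H) ≡ (K′ , H′)
    X-unique _ _ _ _ s s′ x a x′ a′ = unique-by-level X-redundant s s′ (anchoredX x a) (anchoredX x′ a′)

    no-cyclic-below : ∀ k K H → k ≤ n → S K H → ((InD 0 K × InD k H) ⊎ (InC 0 K × InD k H)) →
                      ∀ j K′ H′ → j ≤ k → S K′ H′ → InC 0 K′ → InC j H′ → ⊥
    no-cyclic-below k K H _ s KH j K′ H′ j≤k s′ c0 cj =
      cyclic-redundant s s′ (source KH) (InD⇒Std {k} (target KH)) (InC⇒Std {0} c0) (InC⇒Std {j} cj) j≤k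
      where
        source : (InD 0 K × InD k H) ⊎ (InC 0 K × InD k H) → ∃[ ρ ] K ≡ Std 0 ρ
        source (inj₁ (d0 , _)) = Σ.map just id (InD⇒Std {0} d0)
        source (inj₂ (c0 , _)) = nothing , InC⇒Std {0} c0
        target : (InD 0 K × InD k H) ⊎ (InC 0 K × InD k H) → InD k H
        target = [ proj₂ , proj₂ ]′

lemma4p5 : (p n : ℕ) (pr : Prime p) → p ≢ 2 → 1 ≤ n →
    let open Dihedral p n (prime⇒nonZero pr) in
    (T : Rel) → IsTransferSystem T →
    (S : ArrowSet) → IsMinimalGeneratingSet S T →
    -- (i) at most one left-anchored arrow of each type
    ( (∀ K H K′ H′ → S K H → S K′ H′ →
         IsCArrow K H → LeftAnchored K H →
         IsCArrow K′ H′ → LeftAnchored K′ H′ → (K , H) ≡ (K′ , H′))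
    × (∀ K H K′ H′ → S K H → S K′ H′ →
         IsDArrow K H → LeftAnchored K H →
         IsDArrow K′ H′ → LeftAnchored K′ H′ → (K , H) ≡ (K′ , H′))
    × (∀ K H K′ H′ → S K H → S K′ H′ →
         IsXArrow K H → LeftAnchored K H →
         IsXArrow K′ H′ → LeftAnchored K′ H′ → (K , H) ≡ (K′ , H′)) )
    ×
    -- (ii) a (d_0, d_k) or (c_0, d_k) arrow in S excludes (c_0, c_j) arrows, j ≤ k
    ( ∀ k K H → k ≤ n → S K H → ((InD 0 K × InD k H) Data.Sum.⊎ (InC 0 K × InD k H)) →
        ∀ j K′ H′ → j ≤ k → S K′ H′ → InC 0 K′ → InC j H′ → ⊥ )
lemma4p5 p n pr p≢2 _ T _ S ms = (C-unique , D-unique , X-unique) , no-cyclic-below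
  where
    open DihedralSubgroups p n (prime⇒nonZero pr)
    open MinimalGeneratingSet (^-odd n (prime≢2⇒odd pr p≢2)) ms
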